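{- For every reduced $p/q\in(0,1)$, in the Haros graph $G_{p/q}$ with nodes $u_1,\dots,u_{q+1}$, every node $u_i$ with $2\le i\le q$ has degree strictly smaller than $\deg(u_1)+\deg(u_{q+1})$; that is, under the convention that $u_1$ and $u_{q+1}$ form a single boundary node, the boundary node has the highest degree.
   Context: Farey binary tree: $\ell_1=\{0/1,1/1\}$, and $\ell_{n+1}$ consists of the mediants $\frac{p+p'}{q+q'}$ of all pairs $p/q<p'/q'$ adjacent in $\bigcup_{i\le n}\ell_i$; each reduced $p/q\in(0,1)$ is the mediant of a unique adjacent pair $p_1/q_1<p_2/q_2$ (its parents). Haros graphs: $G_0$ has two nodes joined by an edge. For ordered-node graphs $G$ ($v_1,\dots,v_a$) and $G'$ ($w_1,\dots,w_b$), $G\oplus G'$ has nodes $u_1,\dots,u_{a+b-1}$ obtained by identifying $v_a$ with $w_1$, keeping all edges of $G$ and $G'$, and adding an edge $u_1u_{a+b-1}$. $G_{0/1}=G_{1/1}=G_0$ and $G_{p/q}=G_{p_1/q_1}\oplus G_{p_2/q_2}$; $G_{p/q}$ has $q+1$ nodes. -}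

module Defs where

open import Data.Nat using (ℕ; zero; suc; _+_; _*_; _∸_; _≟_; _<?_)
open import Data.Product using (_×_; _,_)
open import Data.List using (List; []; _∷_; _++_; map; length)
open import Relation.Nullary using (yes; no)

-- A finite (multi)graph on nodes u₁,…,u_n, encoded by the number of
-- nodes n and a list of edges, each edge a pair of 1-based node indices.
record Graph : Set where
  constructor graph
  field
    size  : ℕ
    edges : List (ℕ × ℕ)
open Graph public

G₀ : Graph
G₀ = graph 2 ((1 , 2) ∷ [])

-- G ⊕ G' : identify v_a with w_1 (w_j ↦ u_{a+j-1}), keep all edges,
-- add the edge u_1 u_{a+b-1}.
_⊕_ : Graph → Graph → Graph
graph a es ⊕ graph b es' =
  graph (a + b ∸ 1)
        ((1 , a + b ∸ 1) ∷ es ++ map shift es')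
  where
  shift : ℕ × ℕ → ℕ × ℕ
  shift (x , y) = (x + (a ∸ 1) , y + (a ∸ 1))

endpoints : ℕ → List (ℕ × ℕ) → ℕ
endpoints i [] = 0
endpoints i ((x , y) ∷ es) = hit x + hit y + endpoints i es
  where
  hit : ℕ → ℕ
  hit z with z ≟ i
  ... | yes _ = 1
  ... | no  _ = 0

deg : Graph → ℕ → ℕ
deg G i = endpoints i (edges G)

-- Descent in the Farey (Stern–Brocot) binary tree towards p/q, carrying
-- the current adjacent pair a/b < c/d together with their Haros graphs.
-- The mediant (a+c)/(b+d) has Haros graph G_{a/b} ⊕ G_{c/d}; if it equals
-- p/q we return it, otherwise we descend to the side containing p/q.
-- The fuel bounds the depth (denominators strictly increase, so fuel q
-- suffices for any reduced p/q with denominator q).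
descend : (fuel p q a b c d : ℕ) → Graph → Graph → Graph
descend zero    p q a b c d Gl Gr = Gl ⊕ Gr
descend (suc f) p q a b c d Gl Gr with p * (b + d) ≟ q * (a + c)
... | yes _ = Gl ⊕ Gr
... | no  _ with p * (b + d) <? q * (a + c)
...   | yes _ = descend f p q a b (a + c) (b + d) Gl (Gl ⊕ Gr)
...   | no  _ = descend f p q (a + c) (b + d) c d (Gl ⊕ Gr) Gr

Haros : ℕ → ℕ → Graph
Haros p q = descend q p q 0 1 1 1 G₀ G₀

-- Along the Farey descent towards p/q, the Haros graphs L, R of the current
-- pair of neighbours satisfy an invariant.  Let f be the degree of the first
-- node of L and l that of the last node of R: every interior node of L and of
-- R has degree at most f + l + 1, so does the node where L ⊕ R glues them
-- (degree deg_L(last) + deg_R(first)), and moreover deg_L(last) ≤ l + 1 and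
-- deg_R(first) ≤ f + 1.  A step replaces R or L by L ⊕ R, which raises the
-- bound by one; the last two inequalities are what keeps the newly glued node
-- under the raised bound.  At the end G_{p/q} = L ⊕ R, whose boundary nodes
-- have degrees f + 1 and l + 1, summing to more than the bound.

module Submission where

open import Data.List using (List; []; _∷_; _++_; map)
open import Data.List.Relation.Unary.All as All using (All; []; _∷_)
open import Data.List.Relation.Unary.All.Properties using (++⁺; map⁺)
open import Data.Nat
open import Data.Nat.Coprimality using (Coprime; coprime-divisor)
import Data.Nat.Coprimality as Coprime
open import Data.Nat.Divisibility using (divides; ∣⇒≤)
open import Data.Nat.Properties
open import Data.Nat.Tactic.RingSolver using (solve-∀)
open import Data.Product using (_×_; _,_; proj₁; proj₂; ∃₂)
open import Function using (_∘′_)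
open import Data.Sum using (_⊎_; inj₁; inj₂)
open import Relation.Binary using (tri<; tri≈; tri>)
open import Relation.Binary.PropositionalEquality
open import Relation.Nullary using (yes; no; contradiction)

open import Defs

private
  variable
    G G' L R : Graph
    i j x K lo hi : ℕ
    es : List (ℕ × ℕ)

-- hits and shift agree definitionally with the local helpers of endpoints and _⊕_.
hits : ℕ → ℕ → ℕ
hits z i with z ≟ i
... | yes _ = 1
... | no  _ = 0

endpoints-∷ : ∀ i x y es → endpoints i ((x , y) ∷ es) ≡ hits x i + hits y i + endpoints i es
endpoints-∷ i x y es with x ≟ i | y ≟ i
... | yes _ | yes _ = refl
... | yes _ | no  _ = refl
... | no  _ | yes _ = refl
... | no  _ | no  _ = refl

hits-refl : ∀ i → hits i i ≡ 1
hits-refl i with i ≟ i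
... | yes _  = refl
... | no i≢i = contradiction refl i≢i

hits-≢ : x ≢ i → hits x i ≡ 0
hits-≢ {x} {i} x≢i with x ≟ i
... | yes x≡i = contradiction x≡i x≢i
... | no  _   = refl

hits-+ʳ : ∀ x j k → hits (x + k) (j + k) ≡ hits x j
hits-+ʳ x j k with x ≟ j
... | yes refl = hits-refl (x + k)
... | no  x≢j  = hits-≢ (x≢j ∘′ +-cancelʳ-≡ k x j)

endpoints-++ : ∀ i xs ys → endpoints i (xs ++ ys) ≡ endpoints i xs + endpoints i ys
endpoints-++ i [] ys = refl
endpoints-++ i ((x , y) ∷ xs) ys = begin
  endpoints i ((x , y) ∷ xs ++ ys)                       ≡⟨ endpoints-∷ i x y (xs ++ ys) ⟩
  hits x i + hits y i + endpoints i (xs ++ ys)             ≡⟨ cong (hits x i + hits y i +_) (endpoints-++ i xs ys) ⟩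
  hits x i + hits y i + (endpoints i xs + endpoints i ys) ≡⟨ +-assoc (hits x i + hits y i) _ _ ⟨
  hits x i + hits y i + endpoints i xs + endpoints i ys   ≡⟨ cong (_+ endpoints i ys) (endpoints-∷ i x y xs) ⟨
  endpoints i ((x , y) ∷ xs) + endpoints i ys             ∎
  where open ≡-Reasoning

shift : ℕ → ℕ × ℕ → ℕ × ℕ
shift k e = proj₁ e + k , proj₂ e + k

endpoints-shift : ∀ j k es → endpoints (j + k) (map (shift k) es) ≡ endpoints j es
endpoints-shift j k [] = refl
endpoints-shift j k ((x , y) ∷ es)
  rewrite endpoints-∷ (j + k) (x + k) (y + k) (map (shift k) es) | endpoints-∷ j x y es
        | hits-+ʳ x j k | hits-+ʳ y j k | endpoints-shift j k es = refl

EdgeWithin : ℕ → ℕ → ℕ × ℕ → Set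
EdgeWithin lo hi e = lo ≤ proj₁ e × proj₁ e ≤ hi × lo ≤ proj₂ e × proj₂ e ≤ hi

EdgeWithin-weaken : ∀ {lo' hi'} → lo' ≤ lo → hi ≤ hi' →
                    ∀ {e} → EdgeWithin lo hi e → EdgeWithin lo' hi' e
EdgeWithin-weaken lo'≤lo hi≤hi' (lo≤x , x≤hi , lo≤y , y≤hi) =
  ≤-trans lo'≤lo lo≤x , ≤-trans x≤hi hi≤hi' , ≤-trans lo'≤lo lo≤y , ≤-trans y≤hi hi≤hi'

EdgeWithin-shift : ∀ k {e} → EdgeWithin lo hi e → EdgeWithin (lo + k) (hi + k) (shift k e)
EdgeWithin-shift k (lo≤x , x≤hi , lo≤y , y≤hi) =
  +-monoˡ-≤ k lo≤x , +-monoˡ-≤ k x≤hi , +-monoˡ-≤ k lo≤y , +-monoˡ-≤ k y≤hi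

outside-≢ : lo ≤ x → x ≤ hi → i < lo ⊎ hi < i → x ≢ i
outside-≢ lo≤x _    (inj₁ i<lo) = >⇒≢ (<-≤-trans i<lo lo≤x)
outside-≢ _    x≤hi (inj₂ hi<i) = <⇒≢ (≤-<-trans x≤hi hi<i)

endpoints-outside : All (EdgeWithin lo hi) es → i < lo ⊎ hi < i → endpoints i es ≡ 0
endpoints-outside {es = []} [] _ = refl
endpoints-outside {es = (x , y) ∷ es} {i = i} ((lo≤x , x≤hi , lo≤y , y≤hi) ∷ within) outside
  rewrite endpoints-∷ i x y es
        | hits-≢ (outside-≢ lo≤x x≤hi outside) | hits-≢ (outside-≢ lo≤y y≤hi outside) =
  endpoints-outside within outside

WellFormed : Graph → Set
WellFormed G = 2 ≤ size G × All (EdgeWithin 1 (size G)) (edges G)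

deg-⊕ : ∀ a' b' es es' i →
        deg (graph (suc a') es ⊕ graph (suc b') es') i
          ≡ hits 1 i + hits (a' + suc b') i + (endpoints i es + endpoints i (map (shift a') es'))
deg-⊕ a' b' es es' i =
  trans (endpoints-∷ i 1 (a' + suc b') (es ++ map (shift a') es'))
        (cong (hits 1 i + hits (a' + suc b') i +_) (endpoints-++ i es (map (shift a') es')))

deg-⊕-interior : ∀ a' b' es es' i → 2 ≤ i → i < a' + suc b' →
                 deg (graph (suc a') es ⊕ graph (suc b') es') i
                   ≡ endpoints i es + endpoints i (map (shift a') es')
deg-⊕-interior a' b' es es' i 2≤i i<n
  rewrite deg-⊕ a' b' es es' i
        | hits-≢ (<⇒≢ 2≤i) | hits-≢ (>⇒≢ i<n) = refl

glue<size-⊕ : ∀ a' b' → 1 ≤ b' → suc a' < a' + suc b'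
glue<size-⊕ a' b' 1≤b' = subst (2 + a' ≤_) (+-comm (suc b') a') (+-monoˡ-≤ a' (s≤s 1≤b'))

deg-⊕-first : WellFormed G → WellFormed G' → deg (G ⊕ G') 1 ≡ suc (deg G 1)
deg-⊕-first {graph (suc a') es} {graph (suc b') es'} (s≤s 1≤a' , _) (s≤s 1≤b' , within')
  rewrite deg-⊕ a' b' es es' 1 | hits-refl 1
        | hits-≢ (>⇒≢ (<-trans (s≤s 1≤a') (glue<size-⊕ a' b' 1≤b')))
        | endpoints-outside (map⁺ (All.map (EdgeWithin-shift a') within')) (inj₁ (s≤s 1≤a'))
        | +-identityʳ (endpoints 1 es) = refl

deg-⊕-last : WellFormed G → WellFormed G' → deg (G ⊕ G') (size (G ⊕ G')) ≡ suc (deg G' (size G'))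
deg-⊕-last {graph (suc a') es} {graph (suc b') es'} (s≤s 1≤a' , within) (s≤s 1≤b' , _)
  rewrite deg-⊕ a' b' es es' (a' + suc b') | hits-refl (a' + suc b')
        | hits-≢ (<⇒≢ (<-trans (s≤s 1≤a') (glue<size-⊕ a' b' 1≤b')))
        | endpoints-outside within (inj₂ (glue<size-⊕ a' b' 1≤b'))
        | +-comm a' (suc b') | endpoints-shift (suc b') a' es' = refl

deg-⊕-left : WellFormed G → WellFormed G' → 2 ≤ i → i < size G → deg (G ⊕ G') i ≡ deg G i
deg-⊕-left {graph (suc a') es} {graph (suc b') es'} {i} (s≤s 1≤a' , _) (s≤s 1≤b' , within') 2≤i i<glue
  rewrite deg-⊕-interior a' b' es es' i 2≤i (<-trans i<glue (glue<size-⊕ a' b' 1≤b'))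
        | endpoints-outside (map⁺ (All.map (EdgeWithin-shift a') within')) (inj₁ i<glue)
        | +-identityʳ (endpoints i es) = refl

deg-⊕-glue : WellFormed G → WellFormed G' → deg (G ⊕ G') (size G) ≡ deg G (size G) + deg G' 1
deg-⊕-glue {graph (suc a') es} {graph (suc b') es'} (s≤s 1≤a' , _) (s≤s 1≤b' , _)
  rewrite deg-⊕-interior a' b' es es' (suc a') (s≤s 1≤a') (glue<size-⊕ a' b' 1≤b')
        | endpoints-shift 1 a' es' = refl

deg-⊕-right : WellFormed G → WellFormed G' → 2 ≤ j → j < size G' →
              deg (G ⊕ G') (j + (size G ∸ 1)) ≡ deg G' j
deg-⊕-right {graph (suc a') es} {graph (suc b') es'} {j} (s≤s 1≤a' , within) (s≤s 1≤b' , _) 2≤j j<size'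
  rewrite deg-⊕-interior a' b' es es' (j + a') (≤-trans 2≤j (m≤m+n j a'))
                         (subst (j + a' <_) (+-comm (suc b') a') (+-monoˡ-< a' j<size'))
        | endpoints-outside within (inj₂ (+-monoˡ-≤ a' 2≤j))
        | endpoints-shift j a' es' = refl

InteriorBound : Graph → ℕ → Set
InteriorBound G K = ∀ i → 2 ≤ i → i < size G → deg G i ≤ K

InteriorBound-mono : ∀ {K'} → K ≤ K' → InteriorBound G K → InteriorBound G K'
InteriorBound-mono K≤K' bound i 2≤i i<n = ≤-trans (bound i 2≤i i<n) K≤K'

InteriorBound-⊕ : WellFormed G → WellFormed G' → InteriorBound G K → InteriorBound G' K →
                  deg G (size G) + deg G' 1 ≤ K → InteriorBound (G ⊕ G') K
InteriorBound-⊕ {graph (suc a') es} {graph (suc b') es'} {K} wf@(s≤s 1≤a' , _) wf' bound bound' glue i 2≤i i<n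
  with <-cmp i (suc a')
... | tri< i<glue _ _ = subst (_≤ K) (sym (deg-⊕-left wf wf' 2≤i i<glue)) (bound i 2≤i i<glue)
... | tri≈ _ refl _ = subst (_≤ K) (sym (deg-⊕-glue wf wf')) glue
... | tri> _ _ glue<i with i ∸ a' | m∸n+n≡m (≤-trans (n≤1+n a') (<⇒≤ glue<i))
...   | j | refl = subst (_≤ K) (sym (deg-⊕-right wf wf' 2≤j j<size')) (bound' j 2≤j j<size')
  where
  2≤j : 2 ≤ j
  2≤j = +-cancelʳ-≤ a' 2 j glue<i
  j<size' : j < suc b'
  j<size' = +-cancelʳ-< a' j (suc b') (subst (j + a' <_) (+-comm a' (suc b')) i<n)

WellFormed-⊕ : WellFormed G → WellFormed G' → WellFormed (G ⊕ G')
WellFormed-⊕ {graph (suc a') es} {graph (suc b') es'} (s≤s 1≤a' , within) (s≤s 1≤b' , within') =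
  ≤-trans (s≤s (s≤s z≤n)) a'<n ,
  (≤-refl , 1≤n , 1≤n , ≤-refl) ∷
  ++⁺ (All.map (EdgeWithin-weaken ≤-refl (<⇒≤ a'<n)) within)
      (map⁺ (All.map (EdgeWithin-weaken (s≤s z≤n) top'≤n ∘′ EdgeWithin-shift a') within'))
  where
  a'<n : suc a' < a' + suc b'
  a'<n = glue<size-⊕ a' b' 1≤b'
  1≤n : 1 ≤ a' + suc b'
  1≤n = ≤-trans (s≤s z≤n) (<⇒≤ a'<n)
  top'≤n : suc b' + a' ≤ a' + suc b'
  top'≤n = ≤-reflexive (+-comm (suc b') a')

record BalancedAt (L R : Graph) (K : ℕ) : Set where
  field
    wf-left        : WellFormed L
    wf-right       : WellFormed R
    interior-left  : InteriorBound L K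
    interior-right : InteriorBound R K
    glue           : deg L (size L) + deg R 1 ≤ K
    last-left      : deg L (size L) ≤ suc (deg R (size R))
    first-right    : deg R 1 ≤ suc (deg L 1)

BalancedAt-interior-⊕ : BalancedAt L R K → InteriorBound (L ⊕ R) K
BalancedAt-interior-⊕ bal = InteriorBound-⊕ wf-left wf-right interior-left interior-right glue
  where open BalancedAt bal

Balanced : Graph → Graph → Set
Balanced L R = BalancedAt L R (suc (deg L 1 + deg R (size R)))

Balanced-G₀ : Balanced G₀ G₀
Balanced-G₀ = record
  { wf-left        = wf₀
  ; wf-right       = wf₀
  ; interior-left  = no-interior
  ; interior-right = no-interior
  ; glue           = s≤s (s≤s z≤n)
  ; last-left      = s≤s z≤n
  ; first-right    = s≤s z≤n
  }
  where
  wf₀ : WellFormed G₀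
  wf₀ = ≤-refl , (≤-refl , s≤s z≤n , s≤s z≤n , ≤-refl) ∷ []
  no-interior : InteriorBound G₀ K
  no-interior i (s≤s (s≤s _)) (s≤s (s≤s ()))

Balanced-⊕ʳ : Balanced L R → Balanced L (L ⊕ R)
Balanced-⊕ʳ {L} {R} bal = subst (BalancedAt L (L ⊕ R)) (sym bound≡) (record
  { wf-left        = wf-left
  ; wf-right       = WellFormed-⊕ wf-left wf-right
  ; interior-left  = InteriorBound-mono {G = L} (n≤1+n _) interior-left
  ; interior-right = InteriorBound-mono {G = L ⊕ R} (n≤1+n _) (BalancedAt-interior-⊕ bal)
  ; glue           = begin
      deg L (size L) + deg (L ⊕ R) 1 ≡⟨ cong (deg L (size L) +_) (deg-⊕-first wf-left wf-right) ⟩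
      deg L (size L) + suc f         ≤⟨ +-monoˡ-≤ (suc f) last-left ⟩
      suc l + suc f                  ≡⟨ cong suc (trans (+-suc l f) (cong suc (+-comm l f))) ⟩
      suc (suc (f + l))              ∎
  ; last-left      = subst (λ d → deg L (size L) ≤ suc d) (sym (deg-⊕-last wf-left wf-right)) (m≤n⇒m≤1+n last-left)
  ; first-right    = ≤-reflexive (deg-⊕-first wf-left wf-right)
  })
  where
  open BalancedAt bal
  open ≤-Reasoning
  f = deg L 1
  l = deg R (size R)
  bound≡ : suc (f + deg (L ⊕ R) (size (L ⊕ R))) ≡ suc (suc (f + l))
  bound≡ = cong suc (trans (cong (f +_) (deg-⊕-last wf-left wf-right)) (+-suc f l))

Balanced-⊕ˡ : Balanced L R → Balanced (L ⊕ R) R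
Balanced-⊕ˡ {L} {R} bal = subst (BalancedAt (L ⊕ R) R) (sym bound≡) (record
  { wf-left        = WellFormed-⊕ wf-left wf-right
  ; wf-right       = wf-right
  ; interior-left  = InteriorBound-mono {G = L ⊕ R} (n≤1+n _) (BalancedAt-interior-⊕ bal)
  ; interior-right = InteriorBound-mono {G = R} (n≤1+n _) interior-right
  ; glue           = begin
      deg (L ⊕ R) (size (L ⊕ R)) + deg R 1 ≡⟨ cong (_+ deg R 1) (deg-⊕-last wf-left wf-right) ⟩
      suc l + deg R 1                      ≤⟨ +-monoʳ-≤ (suc l) first-right ⟩
      suc l + suc f                        ≡⟨ cong suc (trans (+-suc l f) (cong suc (+-comm l f))) ⟩
      suc (suc (f + l))                    ∎
  ; last-left      = ≤-reflexive (deg-⊕-last wf-left wf-right)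
  ; first-right    = subst (λ d → deg R 1 ≤ suc d) (sym (deg-⊕-first wf-left wf-right)) (m≤n⇒m≤1+n first-right)
  })
  where
  open BalancedAt bal
  open ≤-Reasoning
  f = deg L 1
  l = deg R (size R)
  bound≡ : suc (deg (L ⊕ R) 1 + l) ≡ suc (suc (f + l))
  bound≡ = cong (λ d → suc (d + l)) (deg-⊕-first wf-left wf-right)

BoundaryDominates : Graph → Set
BoundaryDominates G = ∀ i → 2 ≤ i → i < size G → deg G i < deg G 1 + deg G (size G)

Balanced⇒BoundaryDominates : Balanced L R → BoundaryDominates (L ⊕ R)
Balanced⇒BoundaryDominates {L} {R} bal i 2≤i i<n = begin-strict
  deg (L ⊕ R) i                                 ≤⟨ BalancedAt-interior-⊕ bal i 2≤i i<n ⟩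
  suc (f + l)                                   <⟨ s≤s (+-monoʳ-< f (n<1+n l)) ⟩
  suc f + suc l
    ≡⟨ cong₂ _+_ (deg-⊕-first wf-left wf-right) (deg-⊕-last wf-left wf-right) ⟨
  deg (L ⊕ R) 1 + deg (L ⊕ R) (size (L ⊕ R))   ∎
  where
  open BalancedAt bal
  open ≤-Reasoning
  f = deg L 1
  l = deg R (size R)

module _ (P : Graph → Graph → Set)
         (P-⊕ʳ : ∀ {L R} → P L R → P L (L ⊕ R))
         (P-⊕ˡ : ∀ {L R} → P L R → P (L ⊕ R) R)
         where

  descend-invariant : ∀ f p q a b c d {Gl Gr} → P Gl Gr →
                      ∃₂ λ L R → descend f p q a b c d Gl Gr ≡ L ⊕ R × P L R
  descend-invariant zero p q a b c d pair = _ , _ , refl , pair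
  descend-invariant (suc f) p q a b c d pair with p * (b + d) ≟ q * (a + c)
  ... | yes _ = _ , _ , refl , pair
  ... | no  _ with p * (b + d) <? q * (a + c)
  ...   | yes _ = descend-invariant f p q a b (a + c) (b + d) (P-⊕ʳ pair)
  ...   | no  _ = descend-invariant f p q (a + c) (b + d) c d (P-⊕ˡ pair)

Haros-BoundaryDominates : ∀ p q → BoundaryDominates (Haros p q)
Haros-BoundaryDominates p q =
  let L , R , Haros≡L⊕R , bal = descend-invariant Balanced Balanced-⊕ʳ Balanced-⊕ˡ q p q 0 1 1 1 Balanced-G₀
  in subst BoundaryDominates (sym Haros≡L⊕R) (Balanced⇒BoundaryDominates bal)

record FareyBracket (p q a b c d : ℕ) : Set where
  field
    below      : q * a < p * b
    above      : p * d < q * c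
    unimodular : b * c ≡ suc (a * d)
    b-pos      : 1 ≤ b
    d-pos      : 1 ≤ d

module _ {p q a b c d : ℕ} (bracket : FareyBracket p q a b c d) where
  open FareyBracket bracket

  -- q = q (bc − ad) = d (pb − qa) + b (qc − pd), and both brackets are positive.
  FareyBracket-denominators : b + d ≤ q
  FareyBracket-denominators = +-cancelʳ-≤ (q * (a * d) + b * (p * d)) (b + d) q (begin
    b + d + (q * (a * d) + b * (p * d)) ≡⟨ expand p q a b d ⟩
    d * suc (q * a) + b * suc (p * d)   ≤⟨ +-mono-≤ (*-monoʳ-≤ d below) (*-monoʳ-≤ b above) ⟩
    d * (p * b) + b * (q * c)           ≡⟨ regroup p q b c d ⟩
    q * (b * c) + b * (p * d)           ≡⟨ cong (λ bc → q * bc + b * (p * d)) unimodular ⟩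
    q * suc (a * d) + b * (p * d)       ≡⟨ collect p q a b d ⟩
    q + (q * (a * d) + b * (p * d))     ∎)
    where
    open ≤-Reasoning
    expand : ∀ p q a b d → b + d + (q * (a * d) + b * (p * d)) ≡ d * suc (q * a) + b * suc (p * d)
    expand = solve-∀
    regroup : ∀ p q b c d → d * (p * b) + b * (q * c) ≡ q * (b * c) + b * (p * d)
    regroup = solve-∀
    collect : ∀ p q a b d → q * suc (a * d) + b * (p * d) ≡ q + (q * (a * d) + b * (p * d))
    collect = solve-∀

  FareyBracket-mediant : Coprime p q → p * (b + d) ≡ q * (a + c) → b + d ≡ q
  FareyBracket-mediant coprime p[b+d]≡q[a+c] = ≤-antisym FareyBracket-denominators
    (∣⇒≤ {{>-nonZero (≤-trans b-pos (m≤m+n b d))}}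
         (coprime-divisor (Coprime.sym coprime) (divides (a + c) (trans p[b+d]≡q[a+c] (*-comm q (a + c))))))

  FareyBracket-left : p * (b + d) < q * (a + c) → FareyBracket p q a b (a + c) (b + d)
  FareyBracket-left mediant-above = record
    { below      = below
    ; above      = mediant-above
    ; unimodular = begin
        b * (a + c)         ≡⟨ expand a b c ⟩
        a * b + b * c       ≡⟨ cong (a * b +_) unimodular ⟩
        a * b + suc (a * d) ≡⟨ collect a b d ⟩
        suc (a * (b + d))   ∎
    ; b-pos      = b-pos
    ; d-pos      = ≤-trans b-pos (m≤m+n b d)
    }
    where
    open ≡-Reasoning
    expand : ∀ a b c → b * (a + c) ≡ a * b + b * c
    expand = solve-∀
    collect : ∀ a b d → a * b + suc (a * d) ≡ suc (a * (b + d))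
    collect = solve-∀

  FareyBracket-right : q * (a + c) < p * (b + d) → FareyBracket p q (a + c) (b + d) c d
  FareyBracket-right mediant-below = record
    { below      = mediant-below
    ; above      = above
    ; unimodular = begin
        (b + d) * c         ≡⟨ *-distribʳ-+ c b d ⟩
        b * c + d * c       ≡⟨ cong (_+ d * c) unimodular ⟩
        suc (a * d) + d * c ≡⟨ collect a c d ⟩
        suc ((a + c) * d)   ∎
    ; b-pos      = ≤-trans b-pos (m≤m+n b d)
    ; d-pos      = d-pos
    }
    where
    open ≡-Reasoning
    collect : ∀ a c d → suc (a * d) + d * c ≡ suc ((a + c) * d)
    collect = solve-∀

size-⊕ : ∀ L R {b d} → size L ≡ suc b → size R ≡ suc d → size (L ⊕ R) ≡ suc (b + d)
size-⊕ L R {b} {d} size-L size-R rewrite size-L | size-R = +-suc b d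

descend-size : ∀ f {p q a b c d Gl Gr} → Coprime p q → FareyBracket p q a b c d →
               size Gl ≡ suc b → size Gr ≡ suc d → q < f + (b + d) →
               size (descend f p q a b c d Gl Gr) ≡ suc q
descend-size zero _ bracket _ _ q<b+d = contradiction (FareyBracket-denominators bracket) (<⇒≱ q<b+d)
descend-size (suc f) {p} {q} {a} {b} {c} {d} {Gl} {Gr} coprime bracket size-l size-r q<f+b+d
  with p * (b + d) ≟ q * (a + c)
... | yes on-mediant = trans (size-⊕ Gl Gr size-l size-r) (cong suc (FareyBracket-mediant bracket coprime on-mediant))
... | no  off-mediant with p * (b + d) <? q * (a + c)
...   | yes left = descend-size f coprime (FareyBracket-left bracket left) size-l (size-⊕ Gl Gr size-l size-r)
                     (≤-<-trans (s≤s⁻¹ q<f+b+d) (+-monoʳ-< f (m<n+m (b + d) (FareyBracket.b-pos bracket))))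
...   | no  right = descend-size f coprime (FareyBracket-right bracket mediant-below)
                      (size-⊕ Gl Gr size-l size-r) size-r
                      (≤-<-trans (s≤s⁻¹ q<f+b+d) (+-monoʳ-< f (m<m+n (b + d) (FareyBracket.d-pos bracket))))
  where
  mediant-below : q * (a + c) < p * (b + d)
  mediant-below = ≤∧≢⇒< (≮⇒≥ right) (off-mediant ∘′ sym)

Haros-size : ∀ p q → Coprime p q → 0 < p → p < q → size (Haros p q) ≡ suc q
Haros-size p q coprime 0<p p<q = descend-size q coprime bracket refl refl (m<m+n q (s≤s z≤n))
  where
  bracket : FareyBracket p q 0 1 1 1
  bracket = record
    { below      = subst₂ _<_ (sym (*-zeroʳ q)) (sym (*-identityʳ p)) 0<p
    ; above      = subst₂ _<_ (sym (*-identityʳ p)) (sym (*-identityʳ q)) p<q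
    ; unimodular = refl
    ; b-pos      = ≤-refl
    ; d-pos      = ≤-refl
    }

corollary7 : ∀ (p q : ℕ) → Coprime p q → 0 < p → p < q →
    ∀ (i : ℕ) → 2 ≤ i → i ≤ q →
    deg (Haros p q) i < deg (Haros p q) 1 + deg (Haros p q) (suc q)
corollary7 p q coprime 0<p p<q i 2≤i i≤q =
  subst (λ n → deg (Haros p q) i < deg (Haros p q) 1 + deg (Haros p q) n) size≡
    (Haros-BoundaryDominates p q i 2≤i (subst (i <_) (sym size≡) (s≤s i≤q)))
  where
  size≡ : size (Haros p q) ≡ suc q
  size≡ = Haros-size p q coprime 0<p p<q
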